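{- Let $(G,S)$ be a semiregular blade and let $H$ be a graph. If $|S| \geq \tau(H)$ then $H$ is a minor of the blade $(G,S)$.
   Context: All graphs are finite and simple. A graph $H$ is a minor of $G$ if a graph isomorphic to $H$ can be obtained from a subgraph of $G$ by contracting edges. A blade is a pair $(G,S)$ where $G$ is a graph and $S\subsetneq V(G)$. For a positive integer $k$, $\mathrm{Fan}(G,S,k)$ is the graph obtained from $k$ disjoint copies of $G$ by identifying the corresponding copies of each vertex of $S$. A graph $H$ is a minor of the blade $(G,S)$ if $H$ is a minor of $\mathrm{Fan}(G,S,k)$ for some $k$. A blade $(G,S)$ is semiregular if $G[S]$ is complete, $G\setminus S$ is connected, and each vertex of $S$ has a neighbor in $V(G)-S$. $\tau(H)$ is the vertex cover number of $H$ (minimum size of a set $X\subseteq V(H)$ with $H-X$ edgeless). -}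

module Defs where

open import Data.Nat using (ℕ; zero; suc; _≤_; _⊓_)
open import Data.Bool using (Bool; true; false; _∧_; _∨_; not; if_then_else_)
open import Data.Fin using (Fin)
open import Data.Fin.Subset using (Subset; _∈_; _∉_; ∣_∣)
open import Data.Vec using (Vec; []; _∷_; lookup)
open import Data.List using (List; []; _∷_; map; _++_; foldr)
open import Data.List using () renaming (allFin to allFinL)
open import Data.Product using (Σ; ∃; ∃₂; _×_)
open import Data.Unit using (⊤)
open import Relation.Binary.PropositionalEquality using (_≡_)
open import Relation.Nullary using (¬_)

record Graph : Set where
  field
    n      : ℕ
    adj    : Fin n → Fin n → Bool
    sym    : ∀ u v → adj u v ≡ adj v u
    irrefl : ∀ u → adj u u ≡ false

open Graph public

Edge : (G : Graph) → Fin (n G) → Fin (n G) → Set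
Edge G u v = adj G u v ≡ true

data Reach {W : Set} (A : W → W → Set) (P : W → Set) : W → W → Set where
  here : ∀ {x} → Reach A P x x
  step : ∀ {x y z} → A x y → P y → Reach A P y z → Reach A P x z

-- the subgraph induced by P is connected (and P is nonempty separately)
Connected : {W : Set} (A : W → W → Set) (P : W → Set) → Set
Connected A P = ∀ x y → P x → P y → Reach A P x y

-- Minors, via branch sets (a minor model): H is a minor of the host
-- graph (W, A) iff there are nonempty, pairwise disjoint, connected
-- branch sets, one per vertex of H, such that every edge of H is
-- realised by an edge of the host between the corresponding branch sets.

record MinorModel (H : Graph) {W : Set} (A : W → W → Set) : Set₁ where
  field
    branch    : Fin (n H) → W → Set
    nonempty  : ∀ u → ∃ λ x → branch u x
    disjoint  : ∀ u v x → branch u x → branch v x → u ≡ v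
    connected : ∀ u → Connected A (branch u)
    edges     : ∀ u v → Edge H u v →
                ∃₂ λ x y → branch u x × branch v y × A x y

IsMinorOf : Graph → Graph → Set₁
IsMinorOf H G = MinorModel H (Edge G)

-- Fan(G,S,k): k copies of G glued along S.  A vertex is either a vertex
-- of S (shared by all copies) or a pair (copy index, vertex not in S).

data FanV (G : Graph) (S : Subset (n G)) (k : ℕ) : Set where
  shared : (x : Fin (n G)) → x ∈ S → FanV G S k
  copy   : Fin k → (x : Fin (n G)) → x ∉ S → FanV G S k

base : ∀ {G S k} → FanV G S k → Fin (n G)
base (shared x _) = x
base (copy _ x _) = x

SameCopy : ∀ {G S k} → FanV G S k → FanV G S k → Set
SameCopy (shared _ _) _            = ⊤
SameCopy (copy _ _ _) (shared _ _) = ⊤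
SameCopy (copy i _ _) (copy j _ _) = i ≡ j

FanAdj : (G : Graph) (S : Subset (n G)) (k : ℕ) →
         FanV G S k → FanV G S k → Set
FanAdj G S k a b = Edge G (base a) (base b) × SameCopy a b

IsMinorOfBlade : Graph → (G : Graph) → Subset (n G) → Set₁
IsMinorOfBlade H G S =
  Σ ℕ λ k → 1 ≤ k × MinorModel H (FanAdj G S k)

ProperSubset : (G : Graph) → Subset (n G) → Set
ProperSubset G S = ∃ λ x → x ∉ S

record Semiregular (G : Graph) (S : Subset (n G)) : Set where
  field
    complete  : ∀ x y → x ∈ S → y ∈ S → ¬ x ≡ y → Edge G x y
    connected : Connected (Edge G) (λ x → x ∉ S)
    attached  : ∀ x → x ∈ S → ∃ λ y → y ∉ S × Edge G x y

allSubsets : ∀ m → List (Subset m)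
allSubsets zero    = [] ∷ []
allSubsets (suc m) = map (true ∷_) (allSubsets m) ++ map (false ∷_) (allSubsets m)

allᵇ : {A : Set} → (A → Bool) → List A → Bool
allᵇ p = foldr (λ a b → p a ∧ b) true

isCover : (H : Graph) → Subset (n H) → Bool
isCover H X = allᵇ (λ u → allᵇ (λ v → not (adj H u v) ∨ lookup X u ∨ lookup X v)
                              (allFinL (n H)))
                  (allFinL (n H))

-- τ(H) : the minimum of |X| over vertex covers X (V(H) itself is a cover,
-- so n H is a valid starting value)
τ : Graph → ℕ
τ H = foldr (λ X m → if isCover H X then ∣ X ∣ ⊓ m else m) (n H) (allSubsets (n H))

-- Take a minimum vertex cover X of H; since |X| ≤ |S| it embeds injectively into S,
-- u ↦ φ u. A vertex u ∈ X is modelled by the single shared vertex φ u, and every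
-- u ∉ X by a private copy of the connected graph G ∖ S. No edge of H has both ends
-- outside X; two cover vertices are joined since S is a clique, and a cover vertex u
-- reaches every copy of G ∖ S because φ u has a neighbour outside S.
{-# OPTIONS --safe #-}
module Submission where

open import Defs
open import Data.Nat using (_≤_)
open import Data.Fin.Subset using (Subset; ∣_∣)

open import Data.Nat using (ℕ; suc; s≤s; z≤n; _⊓_)
open import Data.Nat.Properties using (≤-reflexive; ≤-trans; ⊓-sel)
open import Data.Bool using (Bool; true; false; T; not; _∨_; if_then_else_)
open import Data.Bool.Properties using (T-≡; T-not-≡; T-∧; T-∨)
open import Data.Fin using (Fin; zero; suc; inject₁; inject≤)
open import Data.Fin.Properties using (suc-injective; inject₁-injective; inject≤-injective)
open import Data.Fin.Subset using (_∈_; _∉_; inside; outside; ⊤)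
open import Data.Fin.Subset.Properties using (_∈?_; ∈⊤; ∣⊤∣≡n)
open import Data.Vec using (_∷_; here; there; lookup)
open import Data.Vec.Properties using (lookup⇒[]=)
open import Data.Vec.Properties.WithK using ([]=-irrelevant)
open import Data.List using (List; []; _∷_; foldr)
open import Data.List.Relation.Unary.All as All using (All; []; _∷_)
open import Data.List.Membership.Propositional.Properties using (∈-allFin)
open import Data.Product using (∃; ∃₂; _×_; _,_; Σ-syntax)
open import Data.Sum using (_⊎_; inj₁; inj₂; [_,_]′)
open import Data.Unit using (tt)
open import Function using (_∘_; id)
open import Function.Bundles using (Equivalence)
open import Relation.Binary.PropositionalEquality as ≡
  using (_≡_; refl; trans; cong; subst; subst₂)
open import Relation.Nullary using (¬_; yes; no; contradiction)

open Equivalence using (to; from)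
open ≡.≡-Reasoning

private
  variable
    m m′ : ℕ
    W W′ : Set
    A : W → W → Set
    A′ : W′ → W′ → Set
    P : W → Set
    P′ : W′ → Set

IsVertexCover : (H : Graph) → Subset (n H) → Set
IsVertexCover H X = ∀ u v → Edge H u v → u ∈ X ⊎ v ∈ X

T-allᵇ : (p : W → Bool) (xs : List W) → T (allᵇ p xs) → All (T ∘ p) xs
T-allᵇ p []       _ = []
T-allᵇ p (x ∷ xs) t with to T-∧ t
... | px , pxs = px ∷ T-allᵇ p xs pxs

T-lookup⇒∈ : ∀ {X : Subset m} {x} → T (lookup X x) → x ∈ X
T-lookup⇒∈ {X = X} {x} t = lookup⇒[]= x X (to T-≡ t)

isCover-sound : (H : Graph) (X : Subset (n H)) → isCover H X ≡ true → IsVertexCover H X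
isCover-sound H X ok u v uv with to T-∨ (clause u v)
  where
  clause : ∀ u v → T (not (adj H u v) ∨ lookup X u ∨ lookup X v)
  clause u v = All.lookup (T-allᵇ _ _ (All.lookup (T-allᵇ _ _ (from T-≡ ok)) (∈-allFin u)))
                          (∈-allFin v)
... | inj₁ ¬uv = contradiction (trans (≡.sym uv) (to T-not-≡ ¬uv)) λ ()
... | inj₂ u∨v = [ inj₁ ∘ T-lookup⇒∈ , inj₂ ∘ T-lookup⇒∈ ]′ (to T-∨ u∨v)

foldrMin : (W → Bool) → (W → ℕ) → ℕ → List W → ℕ
foldrMin p size = foldr (λ x m → if p x then size x ⊓ m else m)

foldrMin-attained : (p : W → Bool) (size : W → ℕ) → (∀ {x} → p x ≡ true → P x) →
                    ∀ {d} → ∃ (λ x → P x × size x ≤ d) →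
                    ∀ xs → ∃ λ x → P x × size x ≤ foldrMin p size d xs
foldrMin-attained p size sound default [] = default
foldrMin-attained p size sound default (x ∷ xs)
  with foldrMin-attained p size sound default xs | p x in px
... | ih | false = ih
... | y , Py , y≤m | true with ⊓-sel (size x) (foldrMin p size _ xs)
...   | inj₁ eq = x , sound px , ≤-reflexive (≡.sym eq)
...   | inj₂ eq = y , Py , subst (size y ≤_) (≡.sym eq) y≤m

τ-attained : (H : Graph) → ∃ λ X → IsVertexCover H X × ∣ X ∣ ≤ τ H
τ-attained H = foldrMin-attained (isCover H) ∣_∣ (isCover-sound H _)
                 (⊤ , (λ u v _ → inj₁ ∈⊤) , ≤-reflexive (∣⊤∣≡n (n H)))
                 (allSubsets (n H))

rank : ∀ {p : Subset m} {x} → x ∈ p → Fin ∣ p ∣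
rank {p = inside  ∷ p} here        = zero
rank {p = inside  ∷ p} (there x∈p) = suc (rank x∈p)
rank {p = outside ∷ p} (there x∈p) = rank x∈p

member : (p : Subset m) → Fin ∣ p ∣ → Fin m
member (inside  ∷ p) zero    = zero
member (inside  ∷ p) (suc i) = suc (member p i)
member (outside ∷ p) i       = suc (member p i)

member-∈ : ∀ (p : Subset m) i → member p i ∈ p
member-∈ (inside  ∷ p) zero    = here
member-∈ (inside  ∷ p) (suc i) = there (member-∈ p i)
member-∈ (outside ∷ p) i       = there (member-∈ p i)

member-rank : ∀ {p : Subset m} {x} (x∈p : x ∈ p) → member p (rank x∈p) ≡ x
member-rank {p = inside  ∷ p} here        = refl
member-rank {p = inside  ∷ p} (there x∈p) = cong suc (member-rank x∈p)
member-rank {p = outside ∷ p} (there x∈p) = cong suc (member-rank x∈p)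

member-injective : ∀ (p : Subset m) {i j} → member p i ≡ member p j → i ≡ j
member-injective (inside  ∷ p) {zero}  {zero}  eq = refl
member-injective (inside  ∷ p) {suc i} {suc j} eq =
  cong suc (member-injective p (suc-injective eq))
member-injective (outside ∷ p) eq = member-injective p (suc-injective eq)

module Embedding (p : Subset m) (q : Subset m′) (∣p∣≤∣q∣ : ∣ p ∣ ≤ ∣ q ∣) where

  embed : ∀ {x} → x ∈ p → Fin m′
  embed x∈p = member q (inject≤ (rank x∈p) ∣p∣≤∣q∣)

  embed-∈ : ∀ {x} (x∈p : x ∈ p) → embed x∈p ∈ q
  embed-∈ x∈p = member-∈ q _

  embed-injective : ∀ {x y} (x∈p : x ∈ p) (y∈p : y ∈ p) → embed x∈p ≡ embed y∈p → x ≡ y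
  embed-injective {x} {y} x∈p y∈p eq = begin
    x                   ≡⟨ member-rank x∈p ⟨
    member p (rank x∈p) ≡⟨ cong (member p) rank-x≡rank-y ⟩
    member p (rank y∈p) ≡⟨ member-rank y∈p ⟩
    y                   ∎
    where
    rank-x≡rank-y : rank x∈p ≡ rank y∈p
    rank-x≡rank-y = inject≤-injective _ _ _ _ (member-injective q eq)

Image : (W → W′) → (W → Set) → W′ → Set
Image f P a = ∃ λ x → P x × f x ≡ a

Reach-map : (f : W → W′) → (∀ {x y} → A x y → A′ (f x) (f y)) →
            (∀ {x} → P x → P′ (f x)) → ∀ {x y} → Reach A P x y → Reach A′ P′ (f x) (f y)
Reach-map f hom mono here            = here
Reach-map f hom mono (step xy Py yz) = step (hom xy) (mono Py) (Reach-map f hom mono yz)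

Connected-image : (f : W → W′) → (∀ {x y} → A x y → A′ (f x) (f y)) →
                  Connected A P → Connected A′ (Image f P)
Connected-image f hom conn _ _ (x , Px , refl) (y , Py , refl) =
  Reach-map f hom (λ {z} Pz → z , Pz , refl) (conn x y Px Py)

module Fan (G : Graph) (S : Subset (n G)) (k : ℕ) where

  inCopy : Fin k → Fin (n G) → FanV G S k
  inCopy i x with x ∈? S
  ... | yes x∈S = shared x x∈S
  ... | no  x∉S = copy i x x∉S

  base-inCopy : ∀ i x → base (inCopy i x) ≡ x
  base-inCopy i x with x ∈? S
  ... | yes _ = refl
  ... | no  _ = refl

  inCopy-injectiveʳ : ∀ {i j x y} → inCopy i x ≡ inCopy j y → x ≡ y
  inCopy-injectiveʳ {i} {j} {x} {y} eq = begin
    x                 ≡⟨ base-inCopy i x ⟨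
    base (inCopy i x) ≡⟨ cong base eq ⟩
    base (inCopy j y) ≡⟨ base-inCopy j y ⟩
    y                 ∎

  inCopy-injectiveˡ : ∀ {i j x y} → x ∉ S → inCopy i x ≡ inCopy j y → i ≡ j
  inCopy-injectiveˡ {x = x} {y} x∉S eq with x ∈? S | y ∈? S | eq
  ... | yes x∈S | _     | _    = contradiction x∈S x∉S
  ... | no  _   | no  _ | refl = refl

  inCopy-sameCopy : ∀ i x y → SameCopy (inCopy i x) (inCopy i y)
  inCopy-sameCopy i x y with x ∈? S | y ∈? S
  ... | yes _ | _     = tt
  ... | no  _ | yes _ = tt
  ... | no  _ | no  _ = refl

  shared-sameCopy : ∀ {x} → x ∈ S → ∀ i j y → SameCopy (inCopy i x) (inCopy j y)
  shared-sameCopy {x} x∈S i j y with x ∈? S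
  ... | yes _   = tt
  ... | no  x∉S = contradiction x∈S x∉S

  inCopy-adjacent : ∀ {i j x y} → Edge G x y → SameCopy (inCopy i x) (inCopy j y) →
                    FanAdj G S k (inCopy i x) (inCopy j y)
  inCopy-adjacent {i} {j} {x} {y} xy same =
    subst₂ (Edge G) (≡.sym (base-inCopy i x)) (≡.sym (base-inCopy j y)) xy , same

  inCopy-homomorphism : ∀ i {x y} → Edge G x y → FanAdj G S k (inCopy i x) (inCopy i y)
  inCopy-homomorphism i {x} {y} xy = inCopy-adjacent xy (inCopy-sameCopy i x y)

  shared-adjacent : ∀ {i j x y} → x ∈ S → Edge G x y → FanAdj G S k (inCopy i x) (inCopy j y)
  shared-adjacent x∈S xy = inCopy-adjacent xy (shared-sameCopy x∈S _ _ _)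

  SameCopy-sym : ∀ {a b : FanV G S k} → SameCopy a b → SameCopy b a
  SameCopy-sym {shared _ _} {shared _ _} _    = tt
  SameCopy-sym {shared _ _} {copy _ _ _} _    = tt
  SameCopy-sym {copy _ _ _} {shared _ _} _    = tt
  SameCopy-sym {copy _ _ _} {copy _ _ _} refl = refl

  FanAdj-sym : ∀ {a b} → FanAdj G S k a b → FanAdj G S k b a
  FanAdj-sym {a} {b} (ab , same) = trans (Graph.sym G (base b) (base a)) ab , SameCopy-sym same

module BladeModel (G : Graph) (S : Subset (n G)) (SR : Semiregular G S)
                  (x₀ : Fin (n G)) (x₀∉S : x₀ ∉ S)
                  (H : Graph) (X : Subset (n H)) (cover : IsVertexCover H X)
                  (∣X∣≤∣S∣ : ∣ X ∣ ≤ ∣ S ∣) where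

  open Semiregular SR
  open Embedding X S ∣X∣≤∣S∣
    renaming (embed to φ; embed-∈ to φ-∈; embed-injective to φ-injective)

  -- One copy of G ∖ S per vertex of H; the extra copy keeps k ≥ 1 when H is empty.
  k : ℕ
  k = suc (n H)

  open Fan G S k

  copyOf : Fin (n H) → Fin k
  copyOf = inject₁

  preBranch : Fin (n H) → Fin (n G) → Set
  preBranch u x = (Σ[ u∈X ∈ u ∈ X ] x ≡ φ u∈X) ⊎ (u ∉ X × x ∉ S)

  branch : Fin (n H) → FanV G S k → Set
  branch u = Image (inCopy (copyOf u)) (preBranch u)

  φ-branch : ∀ {u} (u∈X : u ∈ X) → branch u (inCopy (copyOf u) (φ u∈X))
  φ-branch u∈X = _ , inj₁ (u∈X , refl) , refl

  copy-branch : ∀ {u x} → u ∉ X → x ∉ S → branch u (inCopy (copyOf u) x)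
  copy-branch u∉X x∉S = _ , inj₂ (u∉X , x∉S) , refl

  preBranch-connected : ∀ u → Connected (Edge G) (preBranch u)
  preBranch-connected u _ _ (inj₁ (p , refl)) (inj₁ (q , refl))
    rewrite []=-irrelevant p q = here
  preBranch-connected u _ _ (inj₁ (p , _))   (inj₂ (u∉X , _)) = contradiction p u∉X
  preBranch-connected u _ _ (inj₂ (u∉X , _)) (inj₁ (p , _))   = contradiction p u∉X
  preBranch-connected u x y (inj₂ (u∉X , x∉S)) (inj₂ (_ , y∉S)) =
    Reach-map id id (λ z∉S → inj₂ (u∉X , z∉S)) (connected x y x∉S y∉S)

  preBranch-disjoint : ∀ {u v x y} → preBranch u x → preBranch v y →
                       inCopy (copyOf u) x ≡ inCopy (copyOf v) y → u ≡ v
  preBranch-disjoint (inj₁ (p , refl)) (inj₁ (q , refl)) eq =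
    φ-injective p q (inCopy-injectiveʳ eq)
  preBranch-disjoint (inj₁ (p , refl)) (inj₂ (_ , y∉S)) eq =
    contradiction (subst (_∈ S) (inCopy-injectiveʳ eq) (φ-∈ p)) y∉S
  preBranch-disjoint (inj₂ (_ , x∉S)) (inj₁ (q , refl)) eq =
    contradiction (subst (_∈ S) (≡.sym (inCopy-injectiveʳ eq)) (φ-∈ q)) x∉S
  preBranch-disjoint (inj₂ (_ , x∉S)) (inj₂ _) eq =
    inject₁-injective (inCopy-injectiveˡ x∉S eq)

  branch-nonempty : ∀ u → ∃ (branch u)
  branch-nonempty u with u ∈? X
  ... | yes u∈X = _ , φ-branch u∈X
  ... | no  u∉X = _ , copy-branch u∉X x₀∉S

  branch-disjoint : ∀ u v a → branch u a → branch v a → u ≡ v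
  branch-disjoint u v a (x , Bx , refl) (y , By , eq) = preBranch-disjoint Bx By (≡.sym eq)

  branch-connected : ∀ u → Connected (FanAdj G S k) (branch u)
  branch-connected u = Connected-image (inCopy (copyOf u)) (inCopy-homomorphism (copyOf u))
                                       (preBranch-connected u)

  Joined : Fin (n H) → Fin (n H) → Set
  Joined u v = ∃₂ λ a b → branch u a × branch v b × FanAdj G S k a b

  Joined-sym : ∀ {u v} → Joined u v → Joined v u
  Joined-sym (a , b , Ba , Bb , ab) = b , a , Bb , Ba , FanAdj-sym ab

  joined-at-cover : ∀ {u v} → u ∈ X → Edge H u v → Joined u v
  joined-at-cover {u} {v} u∈X uv with v ∈? X
  ... | yes v∈X = _ , _ , φ-branch u∈X , φ-branch v∈X ,
                  shared-adjacent (φ-∈ u∈X) (complete _ _ (φ-∈ u∈X) (φ-∈ v∈X) φu≢φv)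
    where
    φu≢φv : ¬ φ u∈X ≡ φ v∈X
    φu≢φv eq with φ-injective u∈X v∈X eq
    ... | refl = contradiction (trans (≡.sym uv) (irrefl H u)) λ ()
  ... | no v∉X with attached (φ u∈X) (φ-∈ u∈X)
  ...   | y , y∉S , φu-y = _ , _ , φ-branch u∈X , copy-branch v∉X y∉S ,
                           shared-adjacent (φ-∈ u∈X) φu-y

  branch-edges : ∀ u v → Edge H u v → Joined u v
  branch-edges u v uv with cover u v uv
  ... | inj₁ u∈X = joined-at-cover u∈X uv
  ... | inj₂ v∈X = Joined-sym (joined-at-cover v∈X (trans (Graph.sym H v u) uv))

  model : MinorModel H (FanAdj G S k)
  model = record
    { branch    = branch
    ; nonempty  = branch-nonempty
    ; disjoint  = branch-disjoint
    ; connected = branch-connected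
    ; edges     = branch-edges
    }

lemma2p4 : (G : Graph) (S : Subset (n G)) → ProperSubset G S →
           Semiregular G S → (H : Graph) → τ H ≤ ∣ S ∣ →
           IsMinorOfBlade H G S
lemma2p4 G S (x₀ , x₀∉S) SR H τ≤∣S∣ with τ-attained H
... | X , cover , ∣X∣≤τ = k , s≤s z≤n , model
  where open BladeModel G S SR x₀ x₀∉S H X cover (≤-trans ∣X∣≤τ τ≤∣S∣)
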